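{- Let $D$ be a rank two $(\varphi,N,L/K,E)$-module and let $\underline\eta$ be a standard basis of $D$. For $g\in G$ write $[g]_{\underline\eta}$ for the matrix defined by $(g(\eta_1),g(\eta_2))=(\eta_1,\eta_2)[g]_{\underline\eta}$. (1) Suppose $D$ is F-semisimple and not F-scalar. (a) If $N\neq0$, there is a character $\chi:G\to E^\times$ with $[g]_{\underline\eta}=\mathrm{diag}(\chi(g)\cdot\vec1,\chi(g)\cdot\vec1)$ for all $g\in G$. (b) If $N=0$, there are characters $\chi,\psi:G\to E^\times$ with $[g]_{\underline\eta}=\mathrm{diag}(\chi(g)\cdot\vec1,\psi(g)\cdot\vec1)$ for all $g\in G$. (2) If $D$ is F-scalar, there is a group homomorphism $\lambda:G\to GL_2(E)$ such that $[g]_{\underline\eta}$ is the matrix $\lambda(g)$ (each entry $c$ of $\lambda(g)$ being viewed as $c\cdot\vec1\in E^f$) for all $g\in G$. (3) If $D$ is not F-semisimple, there is a character $\chi:G\to E^\times$ with $[g]_{\underline\eta}=\mathrm{diag}(\chi(g)\cdot\vec1,\chi(g)\cdot\vec1)$ for all $g\in G$.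
   Context: Let $p$ be a prime, $K$ a finite extension of $\mathbb{Q}_p$, $L$ a finite Galois extension of $K$ with $G=\mathrm{Gal}(L/K)$, $L_0$ the maximal unramified subextension of $L/\mathbb{Q}_p$, $f=[L_0:\mathbb{Q}_p]$, $\tau$ the absolute Frobenius of $L_0$, and $E$ a finite extension of $\mathbb{Q}_p$ containing the images of all embeddings of $L$. Fix $\iota:L_0\hookrightarrow E$ and identify $L_0\otimes_{\mathbb{Q}_p}E$ with $E^f$ via $x\otimes y\mapsto(\iota(\tau^j(x))y)_{j}$; then $\tau\otimes1$ becomes $\varphi(x_0,\dots,x_{f-1})=(x_1,\dots,x_{f-1},x_0)$. For $g\in G$ let $n(g)\in\{0,\dots,f-1\}$ with $g|_{L_0}=\tau^{n(g)}$; the action $g\otimes1$ becomes $g(x_0,\dots,x_{f-1})=(x_{n(g)},x_{n(g)+1},\dots,x_{n(g)+f-1})$ (indices mod $f$). For $c\in E$, $c\cdot\vec1=(c,\dots,c)$. A rank two $(\varphi,N,L/K,E)$-module is a free $E^f$-module $D$ of rank 2 with: an additive bijection $\varphi$ with $\varphi(av)=\varphi(a)\varphi(v)$; a nilpotent $E^f$-linear $N$ with $N\varphi=p\varphi N$; and an action of $G$ by additive maps with $g(av)=g(a)g(v)$ ($a\in E^f$) commuting with $\varphi$ and $N$. Matrices of operators w.r.t. an ordered basis $\underline\eta=(\eta_1,\eta_2)$ are defined by $(T(\eta_1),T(\eta_2))=(\eta_1,\eta_2)[T]_{\underline\eta}$. $\varphi^f$ is $E^f$-linear; $D$ is F-semisimple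 if $\varphi^f$ is diagonalizable over a finite extension of $E$, F-scalar if $\varphi^f=c\cdot\mathrm{id}$ with $c\in E^\times$, non-F-semisimple otherwise. A standard basis is an ordered basis $\underline\eta$ such that: if $D$ is F-semisimple and not F-scalar, $[\varphi]_{\underline\eta}=\mathrm{diag}(\alpha\cdot\vec1,\delta\cdot\vec1)$ with $\alpha,\delta\in E^\times$, $\alpha^f\ne\delta^f$, and moreover, if $N\neq0$, $\alpha=p\delta$ and $[N]_{\underline\eta}=\begin{pmatrix}\vec0&\vec0\\ \vec1&\vec0\end{pmatrix}$; if $D$ is F-scalar, $[\varphi]_{\underline\eta}=\mathrm{diag}(\alpha\cdot\vec1,\alpha\cdot\vec1)$ with $\alpha\in E^\times$; if $D$ is not F-semisimple, $[\varphi]_{\underline\eta}=\begin{pmatrix}\alpha\cdot\vec1&\vec0\\ \vec1&\alpha\cdot\vec1\end{pmatrix}$ with $\alpha\in E^\times$. -}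

module Defs where

open import Level using (0ℓ)
open import Data.Nat using (ℕ; zero; suc; NonZero) renaming (_+_ to _+ℕ_)
open import Data.Nat.DivMod using (_mod_)
open import Data.Fin using (Fin; toℕ) renaming (zero to fz; suc to fs)
open import Data.Product using (Σ; ∃; _×_; _,_)
open import Data.List using (List)
open import Data.List.Relation.Unary.Any using (Any)
open import Relation.Nullary using (¬_)
open import Relation.Binary.PropositionalEquality using (_≡_)
open import Algebra.Bundles using (CommutativeRing; Group)
open import Algebra.Module.Bundles using (Module)
open import Algebra.Morphism.Structures using (IsRingHomomorphism)
import Algebra.Construct.Pointwise as PW

module _ (R : CommutativeRing 0ℓ 0ℓ) where
  open CommutativeRing R

  natR : ℕ → Carrier
  natR zero    = 0#
  natR (suc n) = 1# + natR n

  powR : Carrier → ℕ → Carrier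
  powR x zero    = 1#
  powR x (suc k) = x * powR x k

  sumR : (m : ℕ) → (Fin m → Carrier) → Carrier
  sumR zero    v = 0#
  sumR (suc m) v = v fz + sumR m (λ i → v (fs i))

  record IsField : Set where
    field
      1≉0     : ¬ (1# ≈ 0#)
      inverse : ∀ x → ¬ (x ≈ 0#) → ∃ λ y → x * y ≈ 1#

  record IsChar0 : Set where
    field
      char0 : ∀ n → ¬ (natR (suc n) ≈ 0#)

  Mat₂ : Set
  Mat₂ = Fin 2 → Fin 2 → Carrier

  _≈M_ : Mat₂ → Mat₂ → Set
  A ≈M B = ∀ i j → A i j ≈ B i j

  _·M_ : Mat₂ → Mat₂ → Mat₂
  (A ·M B) i j = A i fz * B fz j + A i (fs fz) * B (fs fz) j

  idM : Mat₂
  idM fz      fz      = 1#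
  idM fz      (fs _)  = 0#
  idM (fs _)  fz      = 0#
  idM (fs _)  (fs _)  = 1#

  diagM : Carrier → Carrier → Mat₂
  diagM a b fz     fz     = a
  diagM a b fz     (fs _) = 0#
  diagM a b (fs _) fz     = 0#
  diagM a b (fs _) (fs _) = b

  jordanM : Carrier → Mat₂
  jordanM a fz     fz     = a
  jordanM a fz     (fs _) = 0#
  jordanM a (fs _) fz     = 1#
  jordanM a (fs _) (fs _) = a

  nilM : Mat₂
  nilM = jordanM 0#

  IsInvertibleM : Mat₂ → Set
  IsInvertibleM A = ∃ λ B → ((A ·M B) ≈M idM) × ((B ·M A) ≈M idM)

iterate : {A : Set} → (A → A) → ℕ → A → A
iterate T zero    x = x
iterate T (suc k) x = T (iterate T k x)

-- E^f = L₀ ⊗ E, as the pointwise ring Fin f → E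

Ef : (f : ℕ) → CommutativeRing 0ℓ 0ℓ → CommutativeRing 0ℓ 0ℓ
Ef f E = PW.commutativeRing (Fin f) E

module _ {E : CommutativeRing 0ℓ 0ℓ} where
  open CommutativeRing E

  const⃗ : {f : ℕ} → Carrier → Fin f → Carrier
  const⃗ c _ = c

  shift⃗ : (f : ℕ) {{_ : NonZero f}} → ℕ → (Fin f → Carrier) → (Fin f → Carrier)
  shift⃗ f k x j = x ((k +ℕ toℕ j) mod f)

  φ⃗ : (f : ℕ) {{_ : NonZero f}} → (Fin f → Carrier) → (Fin f → Carrier)
  φ⃗ f = shift⃗ f 1

-- Rank two (φ,N,L/K,E)-modules.
--   p : the prime,  E : coefficient field,  f = [L₀ : ℚ_p],
--   G : the group Gal(L/K),  n : G → Fin f  with g|_{L₀} = τ^{n(g)}.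

module _ (p : ℕ) (E : CommutativeRing 0ℓ 0ℓ) (f : ℕ) {{nz : NonZero f}}
         (G : Group 0ℓ 0ℓ) (n : Group.Carrier G → Fin f) where

  private
    module E  = CommutativeRing E
    module G  = Group G
    module Ef' = CommutativeRing (Ef f E)

  gE : G.Carrier → (Fin f → E.Carrier) → (Fin f → E.Carrier)
  gE g = shift⃗ {E} f (toℕ (n g))

  record PhiNModule : Set₁ where
    field
      D : Module (Ef f E) 0ℓ 0ℓ
    open Module D
    field
      φ        : Carrierᴹ → Carrierᴹ
      φ-cong   : ∀ {v w} → v ≈ᴹ w → φ v ≈ᴹ φ w
      φ-+      : ∀ v w → φ (v +ᴹ w) ≈ᴹ φ v +ᴹ φ w
      φ-inj    : ∀ {v w} → φ v ≈ᴹ φ w → v ≈ᴹ w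
      φ-surj   : ∀ w → ∃ λ v → φ v ≈ᴹ w
      φ-semi   : ∀ (a : Fin f → E.Carrier) v → φ (a *ₗ v) ≈ᴹ (φ⃗ {E} f a) *ₗ φ v
      N        : Carrierᴹ → Carrierᴹ
      N-cong   : ∀ {v w} → v ≈ᴹ w → N v ≈ᴹ N w
      N-+      : ∀ v w → N (v +ᴹ w) ≈ᴹ N v +ᴹ N w
      N-lin    : ∀ (a : Fin f → E.Carrier) v → N (a *ₗ v) ≈ᴹ a *ₗ N v
      N-nilp   : ∃ λ k → ∀ v → iterate N k v ≈ᴹ 0ᴹ
      Nφ       : ∀ v → N (φ v) ≈ᴹ const⃗ {E} (natR E p) *ₗ φ (N v)
      act      : G.Carrier → Carrierᴹ → Carrierᴹ
      act-cong : ∀ {g h v w} → g G.≈ h → v ≈ᴹ w → act g v ≈ᴹ act h w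
      act-+    : ∀ g v w → act g (v +ᴹ w) ≈ᴹ act g v +ᴹ act g w
      act-semi : ∀ g (a : Fin f → E.Carrier) v → act g (a *ₗ v) ≈ᴹ gE g a *ₗ act g v
      act-ε    : ∀ v → act G.ε v ≈ᴹ v
      act-∙    : ∀ g h v → act (g G.∙ h) v ≈ᴹ act g (act h v)
      act-φ    : ∀ g v → act g (φ v) ≈ᴹ φ (act g v)
      act-N    : ∀ g v → act g (N v) ≈ᴹ N (act g v)

  module _ (M : PhiNModule) where
    open PhiNModule M
    open Module D

    comb : (Fin 2 → Carrierᴹ) → (Fin 2 → Fin f → E.Carrier) → Carrierᴹ
    comb η a = a fz *ₗ η fz +ᴹ a (fs fz) *ₗ η (fs fz)

    IsBasis : (Fin 2 → Carrierᴹ) → Set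
    IsBasis η = (∀ v → ∃ λ a → v ≈ᴹ comb η a)
              × (∀ a b → comb η a ≈ᴹ comb η b → ∀ i → a i Ef'.≈ b i)

    -- [T]_η = A, i.e. (T η₁, T η₂) = (η₁, η₂) A
    HasMatrix : (Fin 2 → Carrierᴹ) → (Carrierᴹ → Carrierᴹ) → Mat₂ (Ef f E) → Set
    HasMatrix η T A = ∀ j → T (η j) ≈ᴹ comb η (λ i → A i j)

    -- φ^f is diagonalizable over a finite extension E' of E
    FSemisimple : Set₁
    FSemisimple =
      Σ (CommutativeRing 0ℓ 0ℓ) λ E' →
      IsField E' ×
      Σ (E.Carrier → CommutativeRing.Carrier E') λ ι →
      IsRingHomomorphism (CommutativeRing.rawRing E) (CommutativeRing.rawRing E') ι ×
      -- E' is finite-dimensional over ι(E)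
      (Σ ℕ λ m → Σ (Fin m → CommutativeRing.Carrier E') λ b →
         ∀ y → ∃ λ (c : Fin m → E.Carrier) →
           CommutativeRing._≈_ E' y
             (sumR E' m (λ i → CommutativeRing._*_ E' (ι (c i)) (b i)))) ×
      -- a basis η' of D, the matrix A of φ^f in it, and a diagonalization over E'^f
      Σ (Fin 2 → Carrierᴹ) λ η' → IsBasis η' ×
      Σ (Mat₂ (Ef f E)) λ A → HasMatrix η' (iterate φ f) A ×
      Σ (Mat₂ (Ef f E')) λ P → Σ (Mat₂ (Ef f E')) λ Q →
        _≈M_ (Ef f E') (_·M_ (Ef f E') P Q) (idM (Ef f E')) ×
        _≈M_ (Ef f E') (_·M_ (Ef f E') Q P) (idM (Ef f E')) ×
        (let B = _·M_ (Ef f E') (_·M_ (Ef f E') Q (λ i j k → ι (A i j k))) P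
         in _≈M_ (Ef f E') B (diagM (Ef f E') (B fz fz) (B (fs fz) (fs fz))))

    FScalar : Set
    FScalar = ∃ λ c → ¬ (c E.≈ E.0#) × (∀ v → iterate φ f v ≈ᴹ const⃗ {E} c *ₗ v)

    NisZero : Set
    NisZero = ∀ v → N v ≈ᴹ 0ᴹ

    IsStandardBasis : (Fin 2 → Carrierᴹ) → Set₁
    IsStandardBasis η =
      IsBasis η ×
      (FSemisimple → ¬ FScalar →
        Σ E.Carrier λ α → Σ E.Carrier λ δ →
          ¬ (α E.≈ E.0#) × ¬ (δ E.≈ E.0#) ×
          ¬ (powR E α f E.≈ powR E δ f) ×
          HasMatrix η φ (diagM (Ef f E) (const⃗ {E} α) (const⃗ {E} δ)) ×
          (¬ NisZero → (α E.≈ natR E p E.* δ) × HasMatrix η N (nilM (Ef f E)))) ×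
      (FScalar →
        Σ E.Carrier λ α → ¬ (α E.≈ E.0#) ×
          HasMatrix η φ (diagM (Ef f E) (const⃗ {E} α) (const⃗ {E} α))) ×
      (¬ FSemisimple →
        Σ E.Carrier λ α → ¬ (α E.≈ E.0#) ×
          HasMatrix η φ (jordanM (Ef f E) (const⃗ {E} α)))

  record Character : Set where
    field
      χ      : G.Carrier → E.Carrier
      χ-cong : ∀ {g h} → g G.≈ h → χ g E.≈ χ h
      χ-unit : ∀ g → ¬ (χ g E.≈ E.0#)
      χ-hom  : ∀ g h → χ (g G.∙ h) E.≈ χ g E.* χ h

  record GL₂Rep : Set where
    field
      ρ      : G.Carrier → Mat₂ E
      ρ-cong : ∀ {g h} → g G.≈ h → _≈M_ E (ρ g) (ρ h)
      ρ-inv  : ∀ g → IsInvertibleM E (ρ g)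
      ρ-hom  : ∀ g h → _≈M_ E (ρ (g G.∙ h)) (_·M_ E (ρ g) (ρ h))

  -- n is induced by the restriction homomorphism G → Gal(L₀/ℚ_p) ≅ ℤ/f, τ ↦ 1
  IsShiftHom : Set
  IsShiftHom = (∀ {g h} → g G.≈ h → n g ≡ n h)
             × (∀ g h → n (g G.∙ h) ≡ (toℕ (n g) +ℕ toℕ (n h)) mod f)

IsFiniteGroup : Group 0ℓ 0ℓ → Set
IsFiniteGroup G = ∃ λ (xs : List (Group.Carrier G)) → ∀ g → Any (Group._≈_ G g) xs

-- Let A(g) ∈ M₂(E^f) be the matrix of g and A(g)_l ∈ M₂(E) its l-th component.
-- Since g commutes with φ, whose matrix Φ is constant, and φ acts on
-- coordinates by the shift l ↦ l + 1, we get  A(g)_l · Φ = Φ · A(g)_{l+1}.  So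
-- each entry x of A(g) obeys a shift equation x_l u = v x_{l+1}, possibly with
-- an additive drift; going once around the cycle ℤ/f gives x = 0 if uᶠ ≠ vᶠ,
-- x constant if u = v ≠ 0, and no drift in characteristic 0.  For each shape of
-- Φ, A(g) is thus a constant ρ(g) ∈ M₂(E) and ρ is a representation of G:
-- diagonal in case (1); in case (3) lower triangular with equal diagonal, hence
-- diagonal as g has finite order.  In case (1)(a) commuting with N = (0 0; 1 0)
-- equalises the diagonal.
module Submission where

open import Defs
open import Level using (0ℓ)
open import Data.Nat as ℕ using (ℕ; NonZero; zero; suc)
import Data.Nat.Properties as ℕₚ
open import Data.Nat.DivMod using (_mod_; _%_; %-distribˡ-+; m%n%n≡m%n; [m+n]%n≡m%n; m<n⇒m%n≡m)
open import Data.Nat.Primality using (Prime)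
open import Data.Fin using (Fin; toℕ) renaming (zero to fz; suc to fs)
open import Data.Fin.Properties using (toℕ-injective; toℕ-fromℕ<; toℕ<n; pigeonhole)
open import Data.Product using (Σ; ∃; _×_; _,_; proj₁; proj₂)
open import Data.List using (lookup; length)
open import Data.List.Relation.Unary.Any using (index)
open import Data.List.Relation.Unary.Any.Properties using (lookup-index)
open import Relation.Nullary using (¬_)
open import Relation.Binary.PropositionalEquality as ≡ using (_≡_)
open import Algebra.Bundles using (CommutativeRing; Group)
open import Algebra.Module.Bundles using (Module)

module FieldFacts (E : CommutativeRing 0ℓ 0ℓ) (E-field : IsField E) where
  open CommutativeRing E
  open import Relation.Binary.Reasoning.Setoid setoid
  open import Algebra.Properties.Ring ring using (x[y-z]≈xy-xz)
  open import Algebra.Properties.Group +-group using (x∙y⁻¹≈ε⇒x≈y)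

  *-cancelʳ-nonzero : ∀ {u x y} → ¬ (u ≈ 0#) → x * u ≈ y * u → x ≈ y
  *-cancelʳ-nonzero {u} {x} {y} u≉0 xu≈yu with IsField.inverse E-field u u≉0
  ... | w , uw≈1 = begin
    x             ≈⟨ *-identityʳ x ⟨
    x * 1#        ≈⟨ *-congˡ uw≈1 ⟨
    x * (u * w)   ≈⟨ *-assoc x u w ⟨
    (x * u) * w   ≈⟨ *-congʳ xu≈yu ⟩
    (y * u) * w   ≈⟨ *-assoc y u w ⟩
    y * (u * w)   ≈⟨ *-congˡ uw≈1 ⟩
    y * 1#        ≈⟨ *-identityʳ y ⟩
    y             ∎

  *-cancelˡ-nonzero : ∀ {u x y} → ¬ (u ≈ 0#) → u * x ≈ u * y → x ≈ y
  *-cancelˡ-nonzero {u} {x} {y} u≉0 ux≈uy =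
    *-cancelʳ-nonzero u≉0 (trans (*-comm x u) (trans ux≈uy (*-comm u y)))

  x-y≈0⇒x≈y : ∀ {x y} → x - y ≈ 0# → x ≈ y
  x-y≈0⇒x≈y {x} {y} = x∙y⁻¹≈ε⇒x≈y x y

  *-agree-on-distinct⇒zero : ∀ {x a b} → ¬ (a ≈ b) → x * a ≈ x * b → x ≈ 0#
  *-agree-on-distinct⇒zero {x} {a} {b} a≉b xa≈xb =
    *-cancelʳ-nonzero (λ a-b≈0 → a≉b (x-y≈0⇒x≈y a-b≈0)) (begin
      x * (a - b)      ≈⟨ x[y-z]≈xy-xz x a b ⟩
      x * a - x * b    ≈⟨ +-congʳ xa≈xb ⟩
      x * b - x * b    ≈⟨ -‿inverseʳ (x * b) ⟩
      0#               ≈⟨ zeroˡ (a - b) ⟨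
      0# * (a - b)     ∎)

  natR-nonzero : IsChar0 E → ∀ m .{{_ : NonZero m}} → ¬ (natR E m ≈ 0#)
  natR-nonzero char0 (suc m) = IsChar0.char0 char0 m

  x+y*0≈x : ∀ x y → x + y * 0# ≈ x
  x+y*0≈x x y = trans (+-congˡ (zeroʳ y)) (+-identityʳ x)

  x+0*y≈x : ∀ x y → x + 0# * y ≈ x
  x+0*y≈x x y = trans (+-congˡ (zeroˡ y)) (+-identityʳ x)

  y*0+x≈x : ∀ x y → y * 0# + x ≈ x
  y*0+x≈x x y = trans (+-congʳ (zeroʳ y)) (+-identityˡ x)

  0*y+x≈x : ∀ x y → 0# * y + x ≈ x
  0*y+x≈x x y = trans (+-congʳ (zeroˡ y)) (+-identityˡ x)

-- The index set Fin f of E^f as the cycle ℤ/f.  The Frobenius acts on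
-- coordinates through `next` : l ↦ l + 1, i.e. φ⃗ f x l is x (next l).
module CyclicPositions (f : ℕ) {{_ : NonZero f}} where
  open ≡.≡-Reasoning

  next : Fin f → Fin f
  next l = (1 ℕ.+ toℕ l) mod f

  origin : Fin f
  origin = 0 mod f

  [m+k%f]%f≡[m+k]%f : ∀ m k → (m ℕ.+ k % f) % f ≡ (m ℕ.+ k) % f
  [m+k%f]%f≡[m+k]%f m k = begin
    (m ℕ.+ k % f) % f             ≡⟨ %-distribˡ-+ m (k % f) f ⟩
    (m % f ℕ.+ k % f % f) % f     ≡⟨ ≡.cong (λ t → (m % f ℕ.+ t) % f) (m%n%n≡m%n k f) ⟩
    (m % f ℕ.+ k % f) % f         ≡⟨ %-distribˡ-+ m k f ⟨
    (m ℕ.+ k) % f                 ∎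

  toℕ-iterate-next : ∀ k l → toℕ (iterate next k l) ≡ (k ℕ.+ toℕ l) % f
  toℕ-iterate-next zero    l = ≡.sym (m<n⇒m%n≡m (toℕ<n l))
  toℕ-iterate-next (suc k) l = begin
    toℕ (next (iterate next k l))        ≡⟨ toℕ-fromℕ< _ ⟩
    (1 ℕ.+ toℕ (iterate next k l)) % f   ≡⟨ ≡.cong (λ t → (1 ℕ.+ t) % f) (toℕ-iterate-next k l) ⟩
    (1 ℕ.+ (k ℕ.+ toℕ l) % f) % f        ≡⟨ [m+k%f]%f≡[m+k]%f 1 (k ℕ.+ toℕ l) ⟩
    (suc k ℕ.+ toℕ l) % f                ∎

  iterate-next-period : ∀ l → iterate next f l ≡ l
  iterate-next-period l = toℕ-injective (begin
    toℕ (iterate next f l)   ≡⟨ toℕ-iterate-next f l ⟩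
    (f ℕ.+ toℕ l) % f        ≡⟨ ≡.cong (_% f) (ℕₚ.+-comm f (toℕ l)) ⟩
    (toℕ l ℕ.+ f) % f        ≡⟨ [m+n]%n≡m%n (toℕ l) f ⟩
    toℕ l % f                ≡⟨ m<n⇒m%n≡m (toℕ<n l) ⟩
    toℕ l                    ∎)

  iterate-next-from-origin : ∀ l → iterate next (toℕ l) origin ≡ l
  iterate-next-from-origin l = toℕ-injective (begin
    toℕ (iterate next (toℕ l) origin)   ≡⟨ toℕ-iterate-next (toℕ l) origin ⟩
    (toℕ l ℕ.+ toℕ origin) % f          ≡⟨ ≡.cong (λ t → (toℕ l ℕ.+ t) % f) (toℕ-fromℕ< _) ⟩
    (toℕ l ℕ.+ 0 % f) % f               ≡⟨ [m+k%f]%f≡[m+k]%f (toℕ l) 0 ⟩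
    (toℕ l ℕ.+ 0) % f                   ≡⟨ ≡.cong (_% f) (ℕₚ.+-identityʳ (toℕ l)) ⟩
    toℕ l % f                           ≡⟨ m<n⇒m%n≡m (toℕ<n l) ⟩
    toℕ l                               ∎)

module ShiftEquations (E : CommutativeRing 0ℓ 0ℓ) (E-field : IsField E) (E-char0 : IsChar0 E)
                      (f : ℕ) {{_ : NonZero f}} where
  open CommutativeRing E
  open FieldFacts E E-field
  open CyclicPositions f
  open import Relation.Binary.Reasoning.Setoid setoid
  open import Algebra.Properties.Group +-group using (∙-cancelˡ)

  Coord : Set
  Coord = Fin f → Carrier

  TwistedPeriodic : Carrier → Carrier → Coord → Set
  TwistedPeriodic u v x = ∀ l → x l * u ≈ v * x (next l)

  Drifting : Carrier → Carrier → Coord → Set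
  Drifting u c x = ∀ l → x l * u + c ≈ u * x (next l)

  twisted-iterate : ∀ {u v x} → TwistedPeriodic u v x → ∀ k l →
                    x l * powR E u k ≈ powR E v k * x (iterate next k l)
  twisted-iterate {u} {v} {x} twisted zero l = trans (*-identityʳ (x l)) (sym (*-identityˡ (x l)))
  twisted-iterate {u} {v} {x} twisted (suc k) l = begin
      x l * (u * uᵏ)           ≈⟨ *-congˡ (*-comm u uᵏ) ⟩
      x l * (uᵏ * u)           ≈⟨ *-assoc (x l) uᵏ u ⟨
      (x l * uᵏ) * u           ≈⟨ *-congʳ (twisted-iterate twisted k l) ⟩
      (vᵏ * x m) * u           ≈⟨ *-assoc vᵏ (x m) u ⟩
      vᵏ * (x m * u)           ≈⟨ *-congˡ (twisted m) ⟩
      vᵏ * (v * x (next m))    ≈⟨ *-assoc vᵏ v (x (next m)) ⟨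
      (vᵏ * v) * x (next m)    ≈⟨ *-congʳ (*-comm vᵏ v) ⟩
      (v * vᵏ) * x (next m)    ∎
    where
      uᵏ vᵏ : Carrier
      uᵏ = powR E u k
      vᵏ = powR E v k
      m : Fin f
      m = iterate next k l

  -- Once around the cycle: x uᶠ = vᶠ x, so x = 0 when uᶠ ≠ vᶠ.
  twisted-periodic⇒zero : ∀ {u v x} → ¬ (powR E u f ≈ powR E v f) →
                          TwistedPeriodic u v x → ∀ l → x l ≈ 0#
  twisted-periodic⇒zero {u} {v} {x} uᶠ≉vᶠ twisted l = *-agree-on-distinct⇒zero uᶠ≉vᶠ (begin
    x l * powR E u f                    ≈⟨ twisted-iterate twisted f l ⟩
    powR E v f * x (iterate next f l)   ≡⟨ ≡.cong (λ m → powR E v f * x m) (iterate-next-period l) ⟩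
    powR E v f * x l                    ≈⟨ *-comm (powR E v f) (x l) ⟩
    x l * powR E v f                    ∎)

  periodic⇒constant : ∀ {x : Coord} → (∀ l → x l ≈ x (next l)) → ∀ l → x l ≈ x origin
  periodic⇒constant {x} periodic l = sym (begin
      x origin                          ≈⟨ along (toℕ l) ⟩
      x (iterate next (toℕ l) origin)   ≡⟨ ≡.cong x (iterate-next-from-origin l) ⟩
      x l                               ∎)
    where
      along : ∀ k → x origin ≈ x (iterate next k origin)
      along zero    = refl
      along (suc k) = trans (along k) (periodic (iterate next k origin))

  twisted-periodic⇒constant : ∀ {u x} → ¬ (u ≈ 0#) → TwistedPeriodic u u x → ∀ l → x l ≈ x origin
  twisted-periodic⇒constant {u} {x} u≉0 twisted =
    periodic⇒constant (λ l → *-cancelʳ-nonzero u≉0 (trans (twisted l) (*-comm u (x (next l)))))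

  -- In characteristic 0 there is no drift: after f steps the drift adds up to
  -- f·c, which must vanish.
  drifting⇒no-drift : ∀ {u c x} → Drifting u c x → c ≈ 0#
  drifting⇒no-drift {u} {c} {x} drifting =
    *-cancelˡ-nonzero (natR-nonzero E-char0 f)
      (trans (∙-cancelˡ (y origin) _ _ around) (sym (zeroʳ (natR E f))))
    where
      y : Coord
      y l = x l * u
      step : ∀ l → y l + c ≈ y (next l)
      step l = trans (drifting l) (*-comm u (x (next l)))
      accumulate : ∀ k l → y l + natR E k * c ≈ y (iterate next k l)
      accumulate zero    l = x+0*y≈x (y l) c
      accumulate (suc k) l = begin
        y l + (1# + natR E k) * c          ≈⟨ +-congˡ (distribʳ c 1# (natR E k)) ⟩
        y l + (1# * c + natR E k * c)      ≈⟨ +-congˡ (+-cong (*-identityˡ c) refl) ⟩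
        y l + (c + natR E k * c)           ≈⟨ +-congˡ (+-comm c (natR E k * c)) ⟩
        y l + (natR E k * c + c)           ≈⟨ +-assoc (y l) (natR E k * c) c ⟨
        (y l + natR E k * c) + c           ≈⟨ +-congʳ (accumulate k l) ⟩
        y (iterate next k l) + c           ≈⟨ step (iterate next k l) ⟩
        y (next (iterate next k l))        ∎
      around : y origin + natR E f * c ≈ y origin + 0#
      around = begin
        y origin + natR E f * c          ≈⟨ accumulate f origin ⟩
        y (iterate next f origin)        ≡⟨ ≡.cong y (iterate-next-period origin) ⟩
        y origin                         ≈⟨ +-identityʳ (y origin) ⟨
        y origin + 0#                    ∎

  drifting⇒constant : ∀ {u c x} → ¬ (u ≈ 0#) → Drifting u c x → ∀ l → x l ≈ x origin
  drifting⇒constant {u} {c} {x} u≉0 drifting = twisted-periodic⇒constant u≉0 (λ l →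
    trans (sym (trans (+-congˡ (drifting⇒no-drift drifting)) (+-identityʳ (x l * u)))) (drifting l))

-- Powers in a group; k ⋆ g = g ∙ (g ∙ ⋯) with k factors (the library's monoid multiple).
module FiniteGroups (G : Group 0ℓ 0ℓ) where
  open Group G
  open import Algebra.Properties.Monoid.Mult monoid public using (×-homo-+) renaming (_×_ to _⋆_)
  open import Algebra.Properties.Group G using (∙-cancelˡ)
  open import Relation.Binary.Reasoning.Setoid setoid

  -- In a finite group every element has finite order: two of g⁰, …, gᴺ coincide.
  finite-order : IsFiniteGroup G → ∀ g → ∃ λ d → (suc d ⋆ g) ≈ ε
  finite-order (xs , covers) g
    with pigeonhole (ℕₚ.n<1+n (length xs)) (λ k → index (covers (toℕ k ⋆ g)))
  ... | i , j , i<j , same-slot with ℕₚ.m≤n⇒∃[o]m+o≡n i<j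
  ...   | d , [1+i]+d≡j = d , sym (∙-cancelˡ (toℕ i ⋆ g) ε (suc d ⋆ g) (begin
          (toℕ i ⋆ g) ∙ ε                           ≈⟨ identityʳ (toℕ i ⋆ g) ⟩
          toℕ i ⋆ g                                 ≈⟨ lookup-index (covers (toℕ i ⋆ g)) ⟩
          lookup xs (index (covers (toℕ i ⋆ g)))    ≡⟨ ≡.cong (lookup xs) same-slot ⟩
          lookup xs (index (covers (toℕ j ⋆ g)))    ≈⟨ lookup-index (covers (toℕ j ⋆ g)) ⟨
          toℕ j ⋆ g                                 ≡⟨ ≡.cong (_⋆ g) j≡i+[1+d] ⟩
          (toℕ i ℕ.+ suc d) ⋆ g                     ≈⟨ ×-homo-+ g (toℕ i) (suc d) ⟩
          (toℕ i ⋆ g) ∙ (suc d ⋆ g)                 ∎))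
    where
      j≡i+[1+d] : toℕ j ≡ toℕ i ℕ.+ suc d
      j≡i+[1+d] = ≡.trans (≡.sym [1+i]+d≡j) (≡.sym (ℕₚ.+-suc (toℕ i) d))

module MatrixRepresentations (E : CommutativeRing 0ℓ 0ℓ) (E-field : IsField E) (E-char0 : IsChar0 E)
  (G : Group 0ℓ 0ℓ) (ρ : Group.Carrier G → Mat₂ E)
  (ρ-cong : ∀ {g h} → Group._≈_ G g h → _≈M_ E (ρ g) (ρ h))
  (ρ-ε : _≈M_ E (ρ (Group.ε G)) (idM E))
  (ρ-hom : ∀ g h → _≈M_ E (ρ (Group._∙_ G g h)) (_·M_ E (ρ g) (ρ h))) where
  open CommutativeRing E
  open FieldFacts E E-field
  open FiniteGroups G using (_⋆_)
  open import Algebra.Properties.CommutativeSemigroup *-commutativeSemigroup using (x∙yz≈y∙xz)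
  open import Relation.Binary.Reasoning.Setoid setoid
  private module G = Group G

  ρ-invertible : ∀ g → IsInvertibleM E (ρ g)
  ρ-invertible g =
      ρ (g G.⁻¹)
    , (λ i j → trans (sym (ρ-hom g (g G.⁻¹) i j)) (trans (ρ-cong (G.inverseʳ g) i j) (ρ-ε i j)))
    , (λ i j → trans (sym (ρ-hom (g G.⁻¹) g i j)) (trans (ρ-cong (G.inverseˡ g) i j) (ρ-ε i j)))

  multiplicative⇒nonzero : (χ : G.Carrier → Carrier) → (∀ {g h} → g G.≈ h → χ g ≈ χ h) →
    (∀ g h → χ (g G.∙ h) ≈ χ g * χ h) → χ G.ε ≈ 1# → ∀ g → ¬ (χ g ≈ 0#)
  multiplicative⇒nonzero χ χ-cong χ-hom χε≈1 g χg≈0 = IsField.1≉0 E-field (begin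
    1#                   ≈⟨ χε≈1 ⟨
    χ G.ε                ≈⟨ χ-cong (G.inverseʳ g) ⟨
    χ (g G.∙ g G.⁻¹)     ≈⟨ χ-hom g (g G.⁻¹) ⟩
    χ g * χ (g G.⁻¹)     ≈⟨ *-congʳ χg≈0 ⟩
    0# * χ (g G.⁻¹)      ≈⟨ zeroˡ (χ (g G.⁻¹)) ⟩
    0#                   ∎)

  upper-left-multiplicative : (∀ g → ρ g fz (fs fz) ≈ 0#) →
    ∀ g h → ρ (g G.∙ h) fz fz ≈ ρ g fz fz * ρ h fz fz
  upper-left-multiplicative upper-right-zero g h =
    trans (ρ-hom g h fz fz)
      (trans (+-congˡ (trans (*-congʳ (upper-right-zero g)) (zeroˡ _))) (+-identityʳ _))

  lower-right-multiplicative : (∀ g → ρ g (fs fz) fz ≈ 0#) →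
    ∀ g h → ρ (g G.∙ h) (fs fz) (fs fz) ≈ ρ g (fs fz) (fs fz) * ρ h (fs fz) (fs fz)
  lower-right-multiplicative lower-left-zero g h =
    trans (ρ-hom g h (fs fz) (fs fz))
      (trans (+-congʳ (trans (*-congʳ (lower-left-zero g)) (zeroˡ _))) (+-identityˡ _))

  -- In characteristic 0, an element of finite order with ρ(g) = (a 0; c a) has
  -- c = 0: the powers satisfy  a · ρ(gᵏ)₁₀ = k · c · ρ(gᵏ)₀₀.
  finite-order-scalar-triangular⇒diagonal : ∀ g d → (suc d ⋆ g) G.≈ G.ε →
    ρ g fz (fs fz) ≈ 0# → ρ g (fs fz) (fs fz) ≈ ρ g fz fz → ρ g (fs fz) fz ≈ 0#
  finite-order-scalar-triangular⇒diagonal g d gᵈ⁺¹≈ε upper-right-zero equal-diagonal =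
    trans (sym (*-identityʳ c))
      (*-cancelˡ-nonzero (natR-nonzero E-char0 (suc d)) (begin
        natR E (suc d) * (c * 1#)                  ≈⟨ *-congˡ (*-congˡ (ρ-ε fz fz)) ⟨
        natR E (suc d) * (c * ρ G.ε fz fz)         ≈⟨ *-congˡ (*-congˡ (ρ-cong gᵈ⁺¹≈ε fz fz)) ⟨
        natR E (suc d) * (c * ρ (suc d ⋆ g) fz fz) ≈⟨ powers (suc d) ⟨
        a * ρ (suc d ⋆ g) (fs fz) fz               ≈⟨ *-congˡ (trans (ρ-cong gᵈ⁺¹≈ε (fs fz) fz) (ρ-ε (fs fz) fz)) ⟩
        a * 0#                                     ≈⟨ zeroʳ a ⟩
        0#                                         ≈⟨ zeroʳ (natR E (suc d)) ⟨
        natR E (suc d) * 0#                        ∎))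
    where
      a c : Carrier
      a = ρ g fz fz
      c = ρ g (fs fz) fz
      powers : ∀ k → a * ρ (k ⋆ g) (fs fz) fz ≈ natR E k * (c * ρ (k ⋆ g) fz fz)
      powers zero = begin
        a * ρ G.ε (fs fz) fz            ≈⟨ *-congˡ (ρ-ε (fs fz) fz) ⟩
        a * 0#                          ≈⟨ zeroʳ a ⟩
        0#                              ≈⟨ zeroˡ (c * ρ G.ε fz fz) ⟨
        0# * (c * ρ G.ε fz fz)          ∎
      powers (suc k) = begin
        a * ρ (g G.∙ h) (fs fz) fz                    ≈⟨ *-congˡ (ρ-hom g h (fs fz) fz) ⟩
        a * (c * A + ρ g (fs fz) (fs fz) * C)         ≈⟨ *-congˡ (+-congˡ (*-congʳ equal-diagonal)) ⟩
        a * (c * A + a * C)                           ≈⟨ distribˡ a (c * A) (a * C) ⟩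
        a * (c * A) + a * (a * C)                     ≈⟨ +-cong (x∙yz≈y∙xz a c A) (*-congˡ (powers k)) ⟩
        c * (a * A) + a * (natR E k * (c * A))        ≈⟨ +-congˡ (x∙yz≈y∙xz a (natR E k) (c * A)) ⟩
        c * (a * A) + natR E k * (a * (c * A))        ≈⟨ +-cong (*-identityˡ _) (*-congˡ (x∙yz≈y∙xz c a A)) ⟨
        1# * (c * (a * A)) + natR E k * (c * (a * A)) ≈⟨ distribʳ (c * (a * A)) 1# (natR E k) ⟨
        (1# + natR E k) * (c * (a * A))               ≈⟨ *-congˡ (*-congˡ gh₀₀≈aA) ⟨
        (1# + natR E k) * (c * ρ (g G.∙ h) fz fz)     ∎
        where
          h : G.Carrier
          h = k ⋆ g
          A C : Carrier
          A = ρ h fz fz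
          C = ρ h (fs fz) fz
          gh₀₀≈aA : ρ (g G.∙ h) fz fz ≈ a * A
          gh₀₀≈aA = trans (ρ-hom g h fz fz)
                      (trans (+-congˡ (trans (*-congʳ upper-right-zero) (zeroˡ C))) (+-identityʳ (a * A)))

module Coordinates (p : ℕ) (E : CommutativeRing 0ℓ 0ℓ) (f : ℕ) {{_ : NonZero f}}
  (G : Group 0ℓ 0ℓ) (n : Group.Carrier G → Fin f) (M : PhiNModule p E f G n)
  (η : Fin 2 → Module.Carrierᴹ (PhiNModule.D M)) (basis : IsBasis p E f G n M η) where
  open CommutativeRing E
  open PhiNModule M
  open Module D using (Carrierᴹ; _≈ᴹ_; _+ᴹ_; _*ₗ_; ≈ᴹ-setoid; ≈ᴹ-sym; ≈ᴹ-trans; ≈ᴹ-refl;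
    +ᴹ-cong; +ᴹ-comm; +ᴹ-identityʳ; +ᴹ-commutativeMonoid;
    *ₗ-cong; *ₗ-assoc; *ₗ-distribˡ; *ₗ-distribʳ; *ₗ-identityˡ; *ₗ-zeroˡ)
  open import Algebra.Bundles using (CommutativeMonoid)
  open import Algebra.Properties.CommutativeSemigroup
    (CommutativeMonoid.commutativeSemigroup +ᴹ-commutativeMonoid) using (interchange)
  open import Relation.Binary.Reasoning.Setoid ≈ᴹ-setoid
  private module G = Group G

  Coord : Set
  Coord = Fin f → Carrier

  ⟦_⟧ : (Fin 2 → Coord) → Carrierᴹ
  ⟦ x ⟧ = comb p E f G n M η x

  HasMatrixη : (Carrierᴹ → Carrierᴹ) → Mat₂ (Ef f E) → Set
  HasMatrixη = HasMatrix p E f G n M η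

  constM : Mat₂ E → Mat₂ (Ef f E)
  constM B i j = const⃗ {E} (B i j)

  component : Mat₂ (Ef f E) → Fin f → Mat₂ E
  component A l i j = A i j l

  coordinates-unique : ∀ x y → ⟦ x ⟧ ≈ᴹ ⟦ y ⟧ → ∀ i l → x i l ≈ y i l
  coordinates-unique = proj₂ basis

  ⟦⟧-cong : ∀ {x y} → (∀ i l → x i l ≈ y i l) → ⟦ x ⟧ ≈ᴹ ⟦ y ⟧
  ⟦⟧-cong x≈y = +ᴹ-cong (*ₗ-cong (x≈y fz) ≈ᴹ-refl) (*ₗ-cong (x≈y (fs fz)) ≈ᴹ-refl)

  hasMatrix-resp : ∀ T {A B} → (∀ i j l → A i j l ≈ B i j l) → HasMatrixη T A → HasMatrixη T B
  hasMatrix-resp T A≈B hasA j = ≈ᴹ-trans (hasA j) (⟦⟧-cong (λ i → A≈B i j))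

  *ₗ-⟦⟧ : ∀ (s : Coord) x → s *ₗ ⟦ x ⟧ ≈ᴹ ⟦ (λ i l → s l * x i l) ⟧
  *ₗ-⟦⟧ s x = ≈ᴹ-trans (*ₗ-distribˡ s _ _)
    (+ᴹ-cong (≈ᴹ-sym (*ₗ-assoc s (x fz) (η fz))) (≈ᴹ-sym (*ₗ-assoc s (x (fs fz)) (η (fs fz)))))

  +ᴹ-⟦⟧ : ∀ x y → ⟦ x ⟧ +ᴹ ⟦ y ⟧ ≈ᴹ ⟦ (λ i l → x i l + y i l) ⟧
  +ᴹ-⟦⟧ x y = ≈ᴹ-trans (interchange _ _ _ _)
    (+ᴹ-cong (≈ᴹ-sym (*ₗ-distribʳ (η fz) _ _)) (≈ᴹ-sym (*ₗ-distribʳ (η (fs fz)) _ _)))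

  η-coordinates : ∀ j → η j ≈ᴹ ⟦ (λ i → constM (idM E) i j) ⟧
  η-coordinates fz = ≈ᴹ-sym
    (≈ᴹ-trans (+ᴹ-cong (*ₗ-identityˡ (η fz)) (*ₗ-zeroˡ (η (fs fz)))) (+ᴹ-identityʳ (η fz)))
  η-coordinates (fs fz) = ≈ᴹ-sym
    (≈ᴹ-trans (+ᴹ-cong (*ₗ-zeroˡ (η fz)) (*ₗ-identityˡ (η (fs fz))))
              (≈ᴹ-trans (+ᴹ-comm _ _) (+ᴹ-identityʳ (η (fs fz)))))

  record Semilinear : Set where
    field
      T      : Carrierᴹ → Carrierᴹ
      σ      : Coord → Coord
      T-cong : ∀ {v w} → v ≈ᴹ w → T v ≈ᴹ T w
      T-+    : ∀ v w → T (v +ᴹ w) ≈ᴹ T v +ᴹ T w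
      T-semi : ∀ (a : Coord) v → T (a *ₗ v) ≈ᴹ σ a *ₗ T v

  act-semilinear : G.Carrier → Semilinear
  act-semilinear g = record { T = act g ; σ = gE p E f G n g ; T-cong = act-cong G.refl
                            ; T-+ = act-+ g ; T-semi = act-semi g }

  φ-semilinear : Semilinear
  φ-semilinear = record { T = φ ; σ = φ⃗ {E} f ; T-cong = φ-cong ; T-+ = φ-+ ; T-semi = φ-semi }

  N-semilinear : Semilinear
  N-semilinear = record { T = N ; σ = λ a → a ; T-cong = N-cong ; T-+ = N-+ ; T-semi = N-lin }

  semilinear-⟦⟧ : (S : Semilinear) (B : Mat₂ (Ef f E)) → HasMatrixη (Semilinear.T S) B → ∀ x →
    Semilinear.T S ⟦ x ⟧ ≈ᴹ ⟦ (λ i l → Semilinear.σ S (x fz) l * B i fz l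
                                    + Semilinear.σ S (x (fs fz)) l * B i (fs fz) l) ⟧
  semilinear-⟦⟧ S B hasB x = begin
    T ⟦ x ⟧                                                  ≈⟨ T-+ _ _ ⟩
    T (x fz *ₗ η fz) +ᴹ T (x (fs fz) *ₗ η (fs fz))           ≈⟨ +ᴹ-cong (T-semi _ _) (T-semi _ _) ⟩
    σ (x fz) *ₗ T (η fz) +ᴹ σ (x (fs fz)) *ₗ T (η (fs fz))
      ≈⟨ +ᴹ-cong (*ₗ-cong (λ _ → refl) (hasB fz)) (*ₗ-cong (λ _ → refl) (hasB (fs fz))) ⟩
    σ (x fz) *ₗ ⟦ (λ i → B i fz) ⟧ +ᴹ σ (x (fs fz)) *ₗ ⟦ (λ i → B i (fs fz)) ⟧
      ≈⟨ +ᴹ-cong (*ₗ-⟦⟧ (σ (x fz)) (λ i → B i fz)) (*ₗ-⟦⟧ (σ (x (fs fz))) (λ i → B i (fs fz))) ⟩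
    ⟦ (λ i l → σ (x fz) l * B i fz l) ⟧ +ᴹ ⟦ (λ i l → σ (x (fs fz)) l * B i (fs fz) l) ⟧
      ≈⟨ +ᴹ-⟦⟧ (λ i l → σ (x fz) l * B i fz l) (λ i l → σ (x (fs fz)) l * B i (fs fz) l) ⟩
    ⟦ (λ i l → σ (x fz) l * B i fz l + σ (x (fs fz)) l * B i (fs fz) l) ⟧ ∎
    where open Semilinear S

  gMatrix : G.Carrier → Mat₂ (Ef f E)
  gMatrix g i j = proj₁ (proj₁ basis (act g (η j))) i

  gMatrix-spec : ∀ g → HasMatrixη (act g) (gMatrix g)
  gMatrix-spec g j = proj₂ (proj₁ basis (act g (η j)))

  gMatrix-cong : ∀ {g h} → g G.≈ h → ∀ i j l → gMatrix g i j l ≈ gMatrix h i j l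
  gMatrix-cong {g} {h} g≈h i j = coordinates-unique (λ k → gMatrix g k j) (λ k → gMatrix h k j)
    (≈ᴹ-trans (≈ᴹ-sym (gMatrix-spec g j)) (≈ᴹ-trans (act-cong g≈h ≈ᴹ-refl) (gMatrix-spec h j))) i

  gMatrix-ε : ∀ i j l → gMatrix G.ε i j l ≈ constM (idM E) i j l
  gMatrix-ε i j = coordinates-unique (λ k → gMatrix G.ε k j) (λ k → constM (idM E) k j)
    (≈ᴹ-trans (≈ᴹ-sym (gMatrix-spec G.ε j)) (≈ᴹ-trans (act-ε (η j)) (η-coordinates j))) i

  -- The cocycle relation A(gh) = A(g) · g(A(h)), written entrywise.
  gMatrix-∙ : ∀ g h i j l → gMatrix (g G.∙ h) i j l ≈
    gE p E f G n g (gMatrix h fz j) l * gMatrix g i fz l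
      + gE p E f G n g (gMatrix h (fs fz) j) l * gMatrix g i (fs fz) l
  gMatrix-∙ g h i j = coordinates-unique (λ k → gMatrix (g G.∙ h) k j) cocycle (begin
    ⟦ (λ k → gMatrix (g G.∙ h) k j) ⟧     ≈⟨ gMatrix-spec (g G.∙ h) j ⟨
    act (g G.∙ h) (η j)                   ≈⟨ act-∙ g h (η j) ⟩
    act g (act h (η j))                   ≈⟨ act-cong G.refl (gMatrix-spec h j) ⟩
    act g ⟦ (λ k → gMatrix h k j) ⟧
      ≈⟨ semilinear-⟦⟧ (act-semilinear g) (gMatrix g) (gMatrix-spec g) (λ k → gMatrix h k j) ⟩
    ⟦ cocycle ⟧                           ∎) i
    where
      cocycle : Fin 2 → Coord
      cocycle k l = gE p E f G n g (gMatrix h fz j) l * gMatrix g k fz l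
                  + gE p E f G n g (gMatrix h (fs fz) j) l * gMatrix g k (fs fz) l

  commutation-equation : (S : Semilinear) (β : Mat₂ E) → HasMatrixη (Semilinear.T S) (constM β) →
    ∀ g → (∀ v → act g (Semilinear.T S v) ≈ᴹ Semilinear.T S (act g v)) → ∀ l →
    _≈M_ E (_·M_ E (component (gMatrix g) l) β)
           (_·M_ E β (component (λ i j → Semilinear.σ S (gMatrix g i j)) l))
  commutation-equation S β hasβ g commutes l i j =
    trans (+-cong (*-comm _ _) (*-comm _ _))
      (trans (coordinates-unique g∘S-coordinates S∘g-coordinates (begin
        ⟦ g∘S-coordinates ⟧              ≈⟨ semilinear-⟦⟧ (act-semilinear g) (gMatrix g) (gMatrix-spec g) (λ k → constM β k j) ⟨
        act g ⟦ (λ k → constM β k j) ⟧   ≈⟨ act-cong G.refl (hasβ j) ⟨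
        act g (T (η j))                  ≈⟨ commutes (η j) ⟩
        T (act g (η j))                  ≈⟨ T-cong (gMatrix-spec g j) ⟩
        T ⟦ (λ k → gMatrix g k j) ⟧      ≈⟨ semilinear-⟦⟧ S (constM β) hasβ (λ k → gMatrix g k j) ⟩
        ⟦ S∘g-coordinates ⟧              ∎) i l)
      (+-cong (*-comm _ _) (*-comm _ _)))
    where
      open Semilinear S
      g∘S-coordinates S∘g-coordinates : Fin 2 → Coord
      g∘S-coordinates k m = β fz j * gMatrix g k fz m + β (fs fz) j * gMatrix g k (fs fz) m
      S∘g-coordinates k m = σ (gMatrix g fz j) m * β k fz + σ (gMatrix g (fs fz) j) m * β k (fs fz)

module GaloisAction (p : ℕ) (E : CommutativeRing 0ℓ 0ℓ) (E-field : IsField E) (E-char0 : IsChar0 E)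
  (f : ℕ) {{_ : NonZero f}} (G : Group 0ℓ 0ℓ) (n : Group.Carrier G → Fin f)
  (M : PhiNModule p E f G n) (η : Fin 2 → Module.Carrierᴹ (PhiNModule.D M))
  (basis : IsBasis p E f G n M η) where
  open CommutativeRing E
  open FieldFacts E E-field
  open CyclicPositions f
  open ShiftEquations E E-field E-char0 f
  open Coordinates p E f G n M η basis hiding (Coord)
  open PhiNModule M
  open import Algebra.Properties.AbelianGroup +-abelianGroup using (xyx⁻¹≈y)
  open import Relation.Binary.Reasoning.Setoid setoid
  private module G = Group G

  diagM-constant : ∀ α δ i j l →
    diagM (Ef f E) (const⃗ {E} α) (const⃗ {E} δ) i j l ≈ constM (diagM E α δ) i j l
  diagM-constant α δ fz      fz      l = refl
  diagM-constant α δ fz      (fs fz) l = refl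
  diagM-constant α δ (fs fz) fz      l = refl
  diagM-constant α δ (fs fz) (fs fz) l = refl

  jordanM-constant : ∀ α i j l → jordanM (Ef f E) (const⃗ {E} α) i j l ≈ constM (jordanM E α) i j l
  jordanM-constant α fz      fz      l = refl
  jordanM-constant α fz      (fs fz) l = refl
  jordanM-constant α (fs fz) fz      l = refl
  jordanM-constant α (fs fz) (fs fz) l = refl

  -- φ = diag(α·1⃗, δ·1⃗): from A(g)_l · Φ = Φ · A(g)_{l+1}, the entries (a b; c d)
  -- of A(g) are twisted periodic for the twists (α,α), (δ,α), (α,δ), (δ,δ).
  module DiagonalΦ {α δ : Carrier} (hasΦ : HasMatrixη φ (diagM (Ef f E) (const⃗ {E} α) (const⃗ {E} δ)))
                   (g : G.Carrier) where
    private
      commutes : ∀ l → _≈M_ E (_·M_ E (component (gMatrix g) l) (diagM E α δ))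
                              (_·M_ E (diagM E α δ) (component (gMatrix g) (next l)))
      commutes = commutation-equation φ-semilinear (diagM E α δ)
                   (hasMatrix-resp φ (diagM-constant α δ) hasΦ) g (act-φ g)

    upper-left : TwistedPeriodic α α (gMatrix g fz fz)
    upper-left l = trans (sym (x+y*0≈x _ _)) (trans (commutes l fz fz) (x+0*y≈x _ _))

    upper-right : TwistedPeriodic δ α (gMatrix g fz (fs fz))
    upper-right l = trans (sym (y*0+x≈x _ _)) (trans (commutes l fz (fs fz)) (x+0*y≈x _ _))

    lower-left : TwistedPeriodic α δ (gMatrix g (fs fz) fz)
    lower-left l = trans (sym (x+y*0≈x _ _)) (trans (commutes l (fs fz) fz) (0*y+x≈x _ _))

    lower-right : TwistedPeriodic δ δ (gMatrix g (fs fz) (fs fz))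
    lower-right l = trans (sym (y*0+x≈x _ _)) (trans (commutes l (fs fz) (fs fz)) (0*y+x≈x _ _))

  -- φ = (α 0; 1 α): the commutation equations force A(g) = (a 0; c a) with
  -- constant entries, through one twisted and two drifting shift equations.
  module JordanΦ {α : Carrier} (α≉0 : ¬ (α ≈ 0#))
                 (hasΦ : HasMatrixη φ (jordanM (Ef f E) (const⃗ {E} α))) (g : G.Carrier) where
    private
      a b c d : Coord
      a = gMatrix g fz fz
      b = gMatrix g fz (fs fz)
      c = gMatrix g (fs fz) fz
      d = gMatrix g (fs fz) (fs fz)
      commutes : ∀ l → _≈M_ E (_·M_ E (component (gMatrix g) l) (jordanM E α))
                              (_·M_ E (jordanM E α) (component (gMatrix g) (next l)))
      commutes = commutation-equation φ-semilinear (jordanM E α)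
                   (hasMatrix-resp φ (jordanM-constant α) hasΦ) g (act-φ g)

    upper-right-constant : ∀ l → b l ≈ b origin
    upper-right-constant = twisted-periodic⇒constant α≉0 (λ l →
      trans (sym (y*0+x≈x _ _)) (trans (commutes l fz (fs fz)) (x+0*y≈x _ _)))

    -- a_l α + b = α a_{l+1}: the upper-left entry drifts by b, so b = 0.
    upper-left-drifts : Drifting α (b origin) a
    upper-left-drifts l =
      trans (+-congˡ (trans (sym (upper-right-constant l)) (sym (*-identityʳ (b l)))))
            (trans (commutes l fz fz) (x+0*y≈x _ _))

    upper-right-zero : ∀ l → b l ≈ 0#
    upper-right-zero l = trans (upper-right-constant l) (drifting⇒no-drift upper-left-drifts)

    upper-left-constant : ∀ l → a l ≈ a origin
    upper-left-constant = drifting⇒constant α≉0 upper-left-drifts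

    lower-right-constant : ∀ l → d l ≈ d origin
    lower-right-constant = twisted-periodic⇒constant α≉0 (λ l →
      trans (sym (y*0+x≈x _ _)) (trans (commutes l (fs fz) (fs fz))
        (trans (+-congʳ (trans (*-identityˡ (b (next l))) (upper-right-zero (next l))))
               (+-identityˡ (α * d (next l))))))

    lower-left-drifts : Drifting α (d origin - a origin) c
    lower-left-drifts l = begin
      c l * α + (d origin - a origin)                ≈⟨ +-assoc (c l * α) (d origin) (- a origin) ⟨
      (c l * α + d origin) - a origin
        ≈⟨ +-congʳ (+-congˡ (trans (sym (lower-right-constant l)) (sym (*-identityʳ (d l))))) ⟩
      (c l * α + d l * 1#) - a origin                ≈⟨ +-congʳ (commutes l (fs fz) fz) ⟩
      (1# * a (next l) + α * c (next l)) - a origin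
        ≈⟨ +-congʳ (+-congʳ (trans (*-identityˡ (a (next l))) (upper-left-constant (next l)))) ⟩
      (a origin + α * c (next l)) - a origin         ≈⟨ xyx⁻¹≈y (a origin) (α * c (next l)) ⟩
      α * c (next l)                                 ∎

    diagonal-equal : d origin ≈ a origin
    diagonal-equal = x-y≈0⇒x≈y (drifting⇒no-drift lower-left-drifts)

    lower-left-constant : ∀ l → c l ≈ c origin
    lower-left-constant = drifting⇒constant α≉0 lower-left-drifts

  N-equalises-diagonal : HasMatrixη N (nilM (Ef f E)) →
    ∀ g l → gMatrix g (fs fz) (fs fz) l ≈ gMatrix g fz fz l
  N-equalises-diagonal hasN g l = begin
    d                 ≈⟨ *-identityʳ d ⟨
    d * 1#            ≈⟨ y*0+x≈x (d * 1#) c ⟨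
    c * 0# + d * 1#   ≈⟨ commutes l (fs fz) fz ⟩
    1# * a + 0# * c   ≈⟨ x+0*y≈x (1# * a) c ⟩
    1# * a            ≈⟨ *-identityˡ a ⟩
    a                 ∎
    where
      a c d : Carrier
      a = gMatrix g fz fz l
      c = gMatrix g (fs fz) fz l
      d = gMatrix g (fs fz) (fs fz) l
      commutes : ∀ l → _≈M_ E (_·M_ E (component (gMatrix g) l) (nilM E))
                              (_·M_ E (nilM E) (component (gMatrix g) l))
      commutes = commutation-equation N-semilinear (nilM E)
                   (hasMatrix-resp N (jordanM-constant 0#) hasN) g (act-N g)

  -- The component of A(g) at the origin; it is the matrix of g once A(g) is constant.
  ρ : G.Carrier → Mat₂ E
  ρ g i j = gMatrix g i j origin

  ρ-cong : ∀ {g h} → g G.≈ h → _≈M_ E (ρ g) (ρ h)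
  ρ-cong g≈h i j = gMatrix-cong g≈h i j origin

  ρ-ε : _≈M_ E (ρ G.ε) (idM E)
  ρ-ε i j = gMatrix-ε i j origin

  ConstantAction : Set
  ConstantAction = ∀ g i j l → gMatrix g i j l ≈ ρ g i j

  -- When every A(g) is constant, the cocycle relation makes ρ a representation,
  -- and g has matrix ρ(g)·1⃗.
  module Constant (constant : ConstantAction) where
    ρ-hom : ∀ g h → _≈M_ E (ρ (g G.∙ h)) (_·M_ E (ρ g) (ρ h))
    ρ-hom g h i j = trans (gMatrix-∙ g h i j origin)
      (trans (+-cong (*-congʳ (constant h fz j _)) (*-congʳ (constant h (fs fz) j _)))
             (+-cong (*-comm _ _) (*-comm _ _)))

    open MatrixRepresentations E E-field E-char0 G ρ ρ-cong ρ-ε ρ-hom public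

    representation : GL₂Rep p E f G n
    representation = record { ρ = ρ ; ρ-cong = ρ-cong ; ρ-inv = ρ-invertible ; ρ-hom = ρ-hom }

    act-matrix : ∀ g → HasMatrixη (act g) (constM (ρ g))
    act-matrix g = hasMatrix-resp (act g) (constant g) (gMatrix-spec g)

    act-diagonal : ∀ g {x y} → ρ g fz fz ≈ x → ρ g (fs fz) (fs fz) ≈ y →
      ρ g fz (fs fz) ≈ 0# → ρ g (fs fz) fz ≈ 0# →
      HasMatrixη (act g) (diagM (Ef f E) (const⃗ {E} x) (const⃗ {E} y))
    act-diagonal g {x} {y} ρ₀₀≈x ρ₁₁≈y ρ₀₁≈0 ρ₁₀≈0 = hasMatrix-resp (act g) entries (act-matrix g)
      where
        entries : ∀ i j l → constM (ρ g) i j l ≈ diagM (Ef f E) (const⃗ {E} x) (const⃗ {E} y) i j l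
        entries fz      fz      _ = ρ₀₀≈x
        entries fz      (fs fz) _ = ρ₀₁≈0
        entries (fs fz) fz      _ = ρ₁₀≈0
        entries (fs fz) (fs fz) _ = ρ₁₁≈y

    upper-left-character : (∀ g → ρ g fz (fs fz) ≈ 0#) → Character p E f G n
    upper-left-character upper-right-zero = record
      { χ = χ ; χ-cong = λ g≈h → ρ-cong g≈h fz fz
      ; χ-unit = multiplicative⇒nonzero χ (λ g≈h → ρ-cong g≈h fz fz) χ-hom (ρ-ε fz fz)
      ; χ-hom = χ-hom }
      where
        χ : G.Carrier → Carrier
        χ g = ρ g fz fz
        χ-hom : ∀ g h → χ (g G.∙ h) ≈ χ g * χ h
        χ-hom = upper-left-multiplicative upper-right-zero

    lower-right-character : (∀ g → ρ g (fs fz) fz ≈ 0#) → Character p E f G n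
    lower-right-character lower-left-zero = record
      { χ = χ ; χ-cong = λ g≈h → ρ-cong g≈h (fs fz) (fs fz)
      ; χ-unit = multiplicative⇒nonzero χ (λ g≈h → ρ-cong g≈h (fs fz) (fs fz)) χ-hom (ρ-ε (fs fz) (fs fz))
      ; χ-hom = χ-hom }
      where
        χ : G.Carrier → Carrier
        χ g = ρ g (fs fz) (fs fz)
        χ-hom : ∀ g h → χ (g G.∙ h) ≈ χ g * χ h
        χ-hom = lower-right-multiplicative lower-left-zero

  module SemisimpleCase {α δ : Carrier} (α≉0 : ¬ (α ≈ 0#)) (δ≉0 : ¬ (δ ≈ 0#))
                        (αᶠ≉δᶠ : ¬ (powR E α f ≈ powR E δ f))
                        (hasΦ : HasMatrixη φ (diagM (Ef f E) (const⃗ {E} α) (const⃗ {E} δ))) where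
    upper-right-zero : ∀ g l → gMatrix g fz (fs fz) l ≈ 0#
    upper-right-zero g = twisted-periodic⇒zero (λ δᶠ≈αᶠ → αᶠ≉δᶠ (sym δᶠ≈αᶠ)) (DiagonalΦ.upper-right hasΦ g)

    lower-left-zero : ∀ g l → gMatrix g (fs fz) fz l ≈ 0#
    lower-left-zero g = twisted-periodic⇒zero αᶠ≉δᶠ (DiagonalΦ.lower-left hasΦ g)

    constant : ConstantAction
    constant g fz      fz        = twisted-periodic⇒constant α≉0 (DiagonalΦ.upper-left hasΦ g)
    constant g fz      (fs fz) l = trans (upper-right-zero g l) (sym (upper-right-zero g origin))
    constant g (fs fz) fz      l = trans (lower-left-zero g l) (sym (lower-left-zero g origin))
    constant g (fs fz) (fs fz)   = twisted-periodic⇒constant δ≉0 (DiagonalΦ.lower-right hasΦ g)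

    open Constant constant

    two-characters : Σ (Character p E f G n) λ X → Σ (Character p E f G n) λ Y →
      ∀ g → HasMatrixη (act g) (diagM (Ef f E) (const⃗ {E} (Character.χ X g)) (const⃗ {E} (Character.χ Y g)))
    two-characters =
        upper-left-character (λ g → upper-right-zero g origin)
      , lower-right-character (λ g → lower-left-zero g origin)
      , λ g → act-diagonal g refl refl (upper-right-zero g origin) (lower-left-zero g origin)

    one-character : HasMatrixη N (nilM (Ef f E)) → Σ (Character p E f G n) λ X →
      ∀ g → HasMatrixη (act g) (diagM (Ef f E) (const⃗ {E} (Character.χ X g)) (const⃗ {E} (Character.χ X g)))
    one-character hasN =
        upper-left-character (λ g → upper-right-zero g origin)
      , λ g → act-diagonal g refl (N-equalises-diagonal hasN g origin)
                (upper-right-zero g origin) (lower-left-zero g origin)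

  -- Case (2): φ = α·id.  Every entry of A(g) is untwisted periodic, hence constant,
  -- and g acts through the representation ρ.
  module ScalarCase {α : Carrier} (α≉0 : ¬ (α ≈ 0#))
                    (hasΦ : HasMatrixη φ (diagM (Ef f E) (const⃗ {E} α) (const⃗ {E} α))) where
    constant : ConstantAction
    constant g fz      fz      = twisted-periodic⇒constant α≉0 (DiagonalΦ.upper-left hasΦ g)
    constant g fz      (fs fz) = twisted-periodic⇒constant α≉0 (DiagonalΦ.upper-right hasΦ g)
    constant g (fs fz) fz      = twisted-periodic⇒constant α≉0 (DiagonalΦ.lower-left hasΦ g)
    constant g (fs fz) (fs fz) = twisted-periodic⇒constant α≉0 (DiagonalΦ.lower-right hasΦ g)

    open Constant constant

    GL₂-action : Σ (GL₂Rep p E f G n) λ R →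
      ∀ g → HasMatrixη (act g) (λ i j → const⃗ {E} (GL₂Rep.ρ R g i j))
    GL₂-action = representation , act-matrix

  -- Case (3): φ = (α 0; 1 α).  A(g) = ρ(g) = (a 0; c a) is constant, and c = 0
  -- because g has finite order.
  module NonSemisimpleCase (G-finite : IsFiniteGroup G) {α : Carrier} (α≉0 : ¬ (α ≈ 0#))
                           (hasΦ : HasMatrixη φ (jordanM (Ef f E) (const⃗ {E} α))) where
    open module Jordan g = JordanΦ α≉0 hasΦ g
    open FiniteGroups G using (finite-order)

    constant : ConstantAction
    constant g fz      fz        = upper-left-constant g
    constant g fz      (fs fz) l = trans (upper-right-zero g l) (sym (upper-right-zero g origin))
    constant g (fs fz) fz        = lower-left-constant g
    constant g (fs fz) (fs fz)   = lower-right-constant g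

    open Constant constant

    lower-left-zero : ∀ g → ρ g (fs fz) fz ≈ 0#
    lower-left-zero g with finite-order G-finite g
    ... | d , gᵈ⁺¹≈ε = finite-order-scalar-triangular⇒diagonal g d gᵈ⁺¹≈ε
                         (upper-right-zero g origin) (diagonal-equal g)

    one-character : Σ (Character p E f G n) λ X →
      ∀ g → HasMatrixη (act g) (diagM (Ef f E) (const⃗ {E} (Character.χ X g)) (const⃗ {E} (Character.χ X g)))
    one-character =
        upper-left-character (λ g → upper-right-zero g origin)
      , λ g → act-diagonal g refl (diagonal-equal g) (upper-right-zero g origin) (lower-left-zero g)

-- The four cases of the proposition follow from the shapes of φ (and N) granted
-- by the standard basis.
proposition2p8 : (p : ℕ) → Prime p →
    (E : CommutativeRing 0ℓ 0ℓ) → IsField E → IsChar0 E →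
    (f : ℕ) → {{nz : NonZero f}} →
    (G : Group 0ℓ 0ℓ) → IsFiniteGroup G →
    (n : Group.Carrier G → Fin f) → IsShiftHom p E f G n →
    (M : PhiNModule p E f G n) →
    (η : Fin 2 → Module.Carrierᴹ (PhiNModule.D M)) →
    IsStandardBasis p E f G n M η →
    ((FSemisimple p E f G n M → ¬ FScalar p E f G n M → ¬ NisZero p E f G n M →
        Σ (Character p E f G n) λ X →
          ∀ g → HasMatrix p E f G n M η (PhiNModule.act M g)
                  (diagM (Ef f E) (const⃗ {E} (Character.χ X g)) (const⃗ {E} (Character.χ X g)))) ×
     (FSemisimple p E f G n M → ¬ FScalar p E f G n M → NisZero p E f G n M →
        Σ (Character p E f G n) λ X → Σ (Character p E f G n) λ Y →
          ∀ g → HasMatrix p E f G n M η (PhiNModule.act M g)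
                  (diagM (Ef f E) (const⃗ {E} (Character.χ X g)) (const⃗ {E} (Character.χ Y g)))) ×
     (FScalar p E f G n M →
        Σ (GL₂Rep p E f G n) λ R →
          ∀ g → HasMatrix p E f G n M η (PhiNModule.act M g)
                  (λ i j → const⃗ {E} (GL₂Rep.ρ R g i j))) ×
     (¬ FSemisimple p E f G n M →
        Σ (Character p E f G n) λ X →
          ∀ g → HasMatrix p E f G n M η (PhiNModule.act M g)
                  (diagM (Ef f E) (const⃗ {E} (Character.χ X g)) (const⃗ {E} (Character.χ X g)))))
proposition2p8 p _ E E-field E-char0 f G G-finite n _ M η
               (basis , semisimple , scalar , non-semisimple) =
    (λ ss not-scalar N≉0 →
       let (α , δ , α≉0 , δ≉0 , αᶠ≉δᶠ , hasΦ , hasN) = semisimple ss not-scalar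
       in SemisimpleCase.one-character α≉0 δ≉0 αᶠ≉δᶠ hasΦ (proj₂ (hasN N≉0)))
  , (λ ss not-scalar _ →
       let (α , δ , α≉0 , δ≉0 , αᶠ≉δᶠ , hasΦ , _) = semisimple ss not-scalar
       in SemisimpleCase.two-characters α≉0 δ≉0 αᶠ≉δᶠ hasΦ)
  , (λ is-scalar →
       let (α , α≉0 , hasΦ) = scalar is-scalar
       in ScalarCase.GL₂-action α≉0 hasΦ)
  , (λ not-semisimple →
       let (α , α≉0 , hasΦ) = non-semisimple not-semisimple
       in NonSemisimpleCase.one-character G-finite α≉0 hasΦ)
  where open GaloisAction p E E-field E-char0 f G n M η basis
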